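{- Let $b\ge 2$ and $N\ge 1$ be integers and let $\alpha_N(j,k)$, $0\le j,k\le b^N-1$, denote the $(j,k)$-entry of the matrix $S_{b,N}(x)$. Then \[ \alpha_N(j,k)=\begin{cases} \binom{x+d_0-1}{d_0} \binom{x+d_1-1}{d_1} \cdots \binom{x+d_{N-1}-1}{d_{N-1}}, & \text{if } 0\leq k\leq j \leq b^N-1 \text{ and } k \preceq j, \\ 0, & \text{otherwise}, \end{cases} \] where, for $j\ge k$, $j-k=d_0b^0+d_1b^1+\cdots+d_{N-1}b^{N-1}$ is the base-$b$ expansion of $j-k$ (digits $0\le d_i\le b-1$).
   Context: For a variable $z$ and non-negative integer $d$, $\binom{z}{d}=z(z-1)\cdots(z-d+1)/d!$. Rows and columns of matrices are indexed from $0$. $S_{b,1}(x)$ is the $b\times b$ lower-triangular matrix whose $(j,k)$-entry is $\binom{x+j-k-1}{j-k}$ if $0\le k\le j\le b-1$ and $0$ otherwise; for $N\ge1$, $S_{b,N+1}(x)=S_{b,1}(x)\otimes S_{b,N}(x)$, where $\otimes$ is the Kronecker product, so $S_{b,N}(x)$ has size $b^N\times b^N$. Digital dominance: for $0\le k,j\le b^N-1$, $k\preceq j$ means that every base-$b$ digit of $k$ is at most the corresponding base-$b$ digit of $j$. -}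

module Defs where

open import Data.Nat as ℕ using (ℕ; zero; suc; _∸_; _^_; _≤_; _!; NonZero)
open import Data.Nat.Properties using (_!≢0)
open import Data.Fin using (Fin; zero; suc; toℕ; remQuot)
open import Data.Product using (_×_; _,_)
open import Data.Integer using (+_)
open import Data.Rational using (ℚ; _/_; 0ℚ; 1ℚ; _+_; _-_; _*_)
open import Relation.Nullary using (Dec; yes; no)

ℕ→ℚ : ℕ → ℚ
ℕ→ℚ n = (+ n) / 1

falling : ℚ → ℕ → ℚ
falling z zero    = 1ℚ
falling z (suc d) = falling z d * (z - ℕ→ℚ d)

binom : ℚ → ℕ → ℚ
binom z d = falling z d * _/_ (+ 1) (d !) ⦃ d !≢0 ⦄

Mat : ℕ → Set
Mat m = Fin m → Fin m → ℚ

-- Kronecker product: (A ⊗ B)[combine i₁ i₂, combine j₁ j₂] = A[i₁,j₁] * B[i₂,j₂]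
_⊗_ : ∀ {m n} → Mat m → Mat n → Mat (m ℕ.* n)
_⊗_ {m} {n} A B i j with remQuot {m} n i | remQuot {m} n j
... | i₁ , i₂ | j₁ , j₂ = A i₁ j₁ * B i₂ j₂

S₁ : (m : ℕ) → ℚ → Mat m
S₁ m x j k with toℕ k ℕ.≤? toℕ j
... | yes _ = binom (x + ℕ→ℚ (toℕ j ∸ toℕ k) - 1ℚ) (toℕ j ∸ toℕ k)
... | no  _ = 0ℚ

-- S_{b,N}(x) of size b^N, for N ≥ 1: S_{b,1} = S₁ b, S_{b,N+1} = S_{b,1} ⊗ S_{b,N}.
-- (The value at N = 0, the 1×1 identity, is a harmless convention; the theorem assumes N ≥ 1.)
S : (b N : ℕ) → ℚ → Mat (b ^ N)
S b zero          x = λ _ _ → 1ℚ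
S b (suc zero)    x = S₁ (b ^ 1) x
S b (suc (suc N)) x = S₁ b x ⊗ S b (suc N) x

digit : (b : ℕ) → .{{NonZero b}} → ℕ → ℕ → ℕ
digit b zero    n = n ℕ.% b
digit b (suc i) n = digit b i (n ℕ./ b)

_⪯[_,_]_ : ℕ → (b : ℕ) → .{{NonZero b}} → ℕ → ℕ → Set
k ⪯[ b , N ] j = (i : Fin N) → digit b (toℕ i) k ≤ digit b (toℕ i) j

∏ : (N : ℕ) → (Fin N → ℚ) → ℚ
∏ zero    f = 1ℚ
∏ (suc N) f = f zero * ∏ N (λ i → f (suc i))

{-# OPTIONS --safe #-}
module Submission where

-- Write j = b^N q_j + r_j with q_j the leading base-b digit. The Kronecker recursion
-- S_{b,N+1} = S_{b,1} ⊗ S_{b,N} makes the (j,k)-entry the product of S_{b,1}(q_j, q_k) and the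
-- (r_j, r_k)-entry of S_{b,N}, so by induction it is the product over all digit positions i of the
-- one-dimensional entries at (digit_i j, digit_i k). Such a factor vanishes exactly when some
-- digit of k exceeds that of j, and otherwise equals binom(x + d_i - 1, d_i) with d_i = digit_i j − digit_i k,
-- which is digit_i (j − k) because subtracting a digitwise dominated number causes no borrows.

open import Defs
open import Data.Nat as ℕ using (ℕ; zero; suc; _≤_; _<_; _∸_; _^_; NonZero; z≤n; _≤?_)
open import Data.Nat.Properties as ℕ using ()
open import Data.Nat.DivMod
  using (_/_; _%_; m≡m%n+[m/n]*n; m%n<n; m<n⇒m%n≡m; m<n⇒m/n≡0; m*n/n≡m; /-monoˡ-≤; m<n*o⇒m/o<n;
         [m+kn]%n≡m%n; %-remove-+ˡ; +-distrib-/-∣ˡ; +-distrib-/-∣ʳ)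
open import Data.Nat.Divisibility using (_∣_; n∣m*n; m∣m*n)
open import Data.Nat.Tactic.RingSolver using (solve-∀)
open import Data.Fin using (Fin; zero; suc; toℕ; inject₁; fromℕ; remQuot; quotient; remainder)
open import Data.Fin.Properties using (toℕ<n; toℕ-combine; combine-remQuot; toℕ-inject₁; toℕ-fromℕ; ¬∀⟶∃¬)
open import Data.Product using (∃; _×_; _,_)
open import Data.Rational using (ℚ; 0ℚ; 1ℚ; _+_; _-_; _*_)
open import Data.Rational.Properties using (*-comm; *-assoc; *-identityˡ; *-identityʳ; *-zeroˡ; *-zeroʳ)
open import Relation.Binary.PropositionalEquality using (_≡_; refl; sym; trans; cong; cong₂; subst; subst₂; module ≡-Reasoning)
open import Relation.Nullary using (¬_; yes; no)
open import Data.Empty using (⊥-elim)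

open ≡-Reasoning

module _ (b : ℕ) .{{_ : NonZero b}} where

  [r+q*b]%b≡r : ∀ r q → r < b → (r ℕ.+ q ℕ.* b) % b ≡ r
  [r+q*b]%b≡r r q r<b = trans ([m+kn]%n≡m%n r q b) (m<n⇒m%n≡m r<b)

  [r+q*b]/b≡q : ∀ r q → r < b → (r ℕ.+ q ℕ.* b) / b ≡ q
  [r+q*b]/b≡q r q r<b = begin
    (r ℕ.+ q ℕ.* b) / b   ≡⟨ +-distrib-/-∣ʳ r (n∣m*n q) ⟩
    r / b ℕ.+ q ℕ.* b / b ≡⟨ cong₂ ℕ._+_ (m<n⇒m/n≡0 r<b) (m*n/n≡m q b) ⟩
    q                     ∎

  [b^[1+n]*q+r]/b≡b^n*q+r/b : ∀ n q r → (b ^ suc n ℕ.* q ℕ.+ r) / b ≡ b ^ n ℕ.* q ℕ.+ r / b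
  [b^[1+n]*q+r]/b≡b^n*q+r/b n q r = begin
    (b ^ suc n ℕ.* q ℕ.+ r) / b     ≡⟨ cong (λ t → (t ℕ.+ r) / b) (reorder b (b ^ n) q) ⟩
    (b ^ n ℕ.* q ℕ.* b ℕ.+ r) / b   ≡⟨ +-distrib-/-∣ˡ r (n∣m*n (b ^ n ℕ.* q)) ⟩
    b ^ n ℕ.* q ℕ.* b / b ℕ.+ r / b ≡⟨ cong (ℕ._+ r / b) (m*n/n≡m (b ^ n ℕ.* q) b) ⟩
    b ^ n ℕ.* q ℕ.+ r / b           ∎
    where
    reorder : ∀ b p q → b ℕ.* p ℕ.* q ≡ p ℕ.* q ℕ.* b
    reorder = solve-∀

  /b<b^n : ∀ n r → r < b ^ suc n → r / b < b ^ n
  /b<b^n n r r<b^[1+n] = m<n*o⇒m/o<n (subst (r <_) (ℕ.*-comm b (b ^ n)) r<b^[1+n])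

  digit-low : ∀ n q r {i} → i < n → r < b ^ n → digit b i (b ^ n ℕ.* q ℕ.+ r) ≡ digit b i r
  digit-low (suc n) q r {zero} _ _ =
    %-remove-+ˡ r (subst (b ∣_) (sym (ℕ.*-assoc b (b ^ n) q)) (m∣m*n (b ^ n ℕ.* q)))
  digit-low (suc n) q r {suc i} (ℕ.s≤s i<n) r<b^[1+n] rewrite [b^[1+n]*q+r]/b≡b^n*q+r/b n q r =
    digit-low n q (r / b) i<n (/b<b^n n r r<b^[1+n])

  digit-high : ∀ n q r → r < b ^ n → digit b n (b ^ n ℕ.* q ℕ.+ r) ≡ q % b
  digit-high zero    q zero    _ = cong (_% b) (trans (ℕ.+-identityʳ _) (ℕ.*-identityˡ q))
  digit-high zero    q (suc r) (ℕ.s≤s ())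
  digit-high (suc n) q r r<b^[1+n] rewrite [b^[1+n]*q+r]/b≡b^n*q+r/b n q r =
    digit-high n q (r / b) (/b<b^n n r r<b^[1+n])

  ∸-without-borrow : ∀ {m n} → m ≤ n → m % b ≤ n % b →
                     n ∸ m ≡ (n % b ∸ m % b) ℕ.+ (n / b ∸ m / b) ℕ.* b
  ∸-without-borrow {m} {n} m≤n m%b≤n%b = begin
    n ∸ m                ≡⟨ cong (_∸ m) (sym difference+m≡n) ⟩
    difference ℕ.+ m ∸ m ≡⟨ ℕ.m+n∸n≡m difference m ⟩
    difference           ∎
    where
    difference : ℕ
    difference = (n % b ∸ m % b) ℕ.+ (n / b ∸ m / b) ℕ.* b
    regroup : ∀ r q r′ q′ b → (r ℕ.+ q ℕ.* b) ℕ.+ (r′ ℕ.+ q′ ℕ.* b) ≡ (r ℕ.+ r′) ℕ.+ (q ℕ.+ q′) ℕ.* b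
    regroup = solve-∀
    difference+m≡n : difference ℕ.+ m ≡ n
    difference+m≡n = begin
      difference ℕ.+ m
        ≡⟨ cong (difference ℕ.+_) (m≡m%n+[m/n]*n m b) ⟩
      difference ℕ.+ (m % b ℕ.+ m / b ℕ.* b)
        ≡⟨ regroup (n % b ∸ m % b) (n / b ∸ m / b) (m % b) (m / b) b ⟩
      (n % b ∸ m % b ℕ.+ m % b) ℕ.+ (n / b ∸ m / b ℕ.+ m / b) ℕ.* b
        ≡⟨ cong₂ (λ r q → r ℕ.+ q ℕ.* b) (ℕ.m∸n+n≡m m%b≤n%b) (ℕ.m∸n+n≡m (/-monoˡ-≤ b m≤n)) ⟩
      n % b ℕ.+ n / b ℕ.* b
        ≡⟨ sym (m≡m%n+[m/n]*n n b) ⟩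
      n ∎

  last-digit<b : ∀ m n → n % b ∸ m % b < b
  last-digit<b m n = ℕ.≤-<-trans (ℕ.m∸n≤m (n % b) (m % b)) (m%n<n n b)

  digit-∸ : ∀ {N} m n → m ≤ n → m ⪯[ b , N ] n → (i : Fin N) →
            digit b (toℕ i) (n ∸ m) ≡ digit b (toℕ i) n ∸ digit b (toℕ i) m
  digit-∸ m n m≤n m⪯n zero    rewrite ∸-without-borrow m≤n (m⪯n zero) =
    [r+q*b]%b≡r _ (n / b ∸ m / b) (last-digit<b m n)
  digit-∸ m n m≤n m⪯n (suc i) rewrite ∸-without-borrow m≤n (m⪯n zero)
                                  | [r+q*b]/b≡q _ (n / b ∸ m / b) (last-digit<b m n) =
    digit-∸ (m / b) (n / b) (/-monoˡ-≤ b m≤n) (λ i → m⪯n (suc i)) i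

  ⪯⇒≤ : ∀ N m n → m < b ^ N → m ⪯[ b , N ] n → m ≤ n
  ⪯⇒≤ zero    zero    n _          _   = z≤n
  ⪯⇒≤ zero    (suc m) n (ℕ.s≤s ()) _
  ⪯⇒≤ (suc N) m       n m<b^[1+N]  m⪯n =
    subst₂ _≤_ (sym (m≡m%n+[m/n]*n m b)) (sym (m≡m%n+[m/n]*n n b))
      (ℕ.+-mono-≤ (m⪯n zero) (ℕ.*-monoˡ-≤ b quotient≤))
    where
    quotient≤ : m / b ≤ n / b
    quotient≤ = ⪯⇒≤ N (m / b) (n / b) (/b<b^n N m m<b^[1+N]) (λ i → m⪯n (suc i))

  ¬⪯⇒digit> : ∀ {N} m n → ¬ m ⪯[ b , N ] n → ∃ λ (i : Fin N) → ¬ digit b (toℕ i) m ≤ digit b (toℕ i) n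
  ¬⪯⇒digit> {N} m n = ¬∀⟶∃¬ N _ (λ i → digit b (toℕ i) m ≤? digit b (toℕ i) n)

∏-cong : ∀ n {f g : Fin n → ℚ} → (∀ i → f i ≡ g i) → ∏ n f ≡ ∏ n g
∏-cong zero    f≗g = refl
∏-cong (suc n) f≗g = cong₂ _*_ (f≗g zero) (∏-cong n (λ i → f≗g (suc i)))

∏-snoc : ∀ n (f : Fin (suc n) → ℚ) → ∏ (suc n) f ≡ ∏ n (λ i → f (inject₁ i)) * f (fromℕ n)
∏-snoc zero    f = trans (*-identityʳ (f zero)) (sym (*-identityˡ (f zero)))
∏-snoc (suc n) f = begin
  f zero * ∏ (suc n) (λ i → f (suc i))
    ≡⟨ cong (f zero *_) (∏-snoc n (λ i → f (suc i))) ⟩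
  f zero * (∏ n (λ i → f (suc (inject₁ i))) * f (fromℕ (suc n)))
    ≡⟨ sym (*-assoc (f zero) _ _) ⟩
  f zero * ∏ n (λ i → f (suc (inject₁ i))) * f (fromℕ (suc n)) ∎

∏-zero : ∀ {n} (f : Fin n → ℚ) (i : Fin n) → f i ≡ 0ℚ → ∏ n f ≡ 0ℚ
∏-zero {suc n} f zero    fi≡0 = trans (cong (_* ∏ n (λ i → f (suc i))) fi≡0) (*-zeroˡ (∏ n (λ i → f (suc i))))
∏-zero {suc n} f (suc i) fi≡0 = trans (cong (f zero *_) (∏-zero (λ i → f (suc i)) i fi≡0)) (*-zeroʳ (f zero))

toℕ-remQuot : ∀ {m} n (i : Fin (m ℕ.* n)) → toℕ i ≡ n ℕ.* toℕ (quotient {m} n i) ℕ.+ toℕ (remainder {m} n i)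
toℕ-remQuot {m} n i = trans (cong toℕ (sym (combine-remQuot {m} n i))) (toℕ-combine (quotient {m} n i) (remainder {m} n i))

⊗-entry : ∀ {m n} (A : Mat m) (B : Mat n) i j →
          (A ⊗ B) i j ≡ A (quotient {m} n i) (quotient {m} n j) * B (remainder {m} n i) (remainder {m} n j)
⊗-entry {m} {n} A B i j with remQuot {m} n i | remQuot {m} n j
... | _ , _ | _ , _ = refl

multichoose : ℚ → ℕ → ℚ
multichoose x d = binom (x + ℕ→ℚ d - 1ℚ) d

S₁-entry : ℚ → ℕ → ℕ → ℚ
S₁-entry x j k with k ≤? j
... | yes _ = multichoose x (j ∸ k)
... | no  _ = 0ℚ

S₁≡S₁-entry : ∀ m x (j k : Fin m) → S₁ m x j k ≡ S₁-entry x (toℕ j) (toℕ k)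
S₁≡S₁-entry m x j k with toℕ k ≤? toℕ j
... | yes _ = refl
... | no  _ = refl

S₁-entry-≤ : ∀ x {j k} → k ≤ j → S₁-entry x j k ≡ multichoose x (j ∸ k)
S₁-entry-≤ x {j} {k} k≤j with k ≤? j
... | yes _   = refl
... | no  k≰j = ⊥-elim (k≰j k≤j)

S₁-entry-≰ : ∀ x {j k} → ¬ k ≤ j → S₁-entry x j k ≡ 0ℚ
S₁-entry-≰ x {j} {k} k≰j with k ≤? j
... | yes k≤j = ⊥-elim (k≰j k≤j)
... | no  _   = refl

module _ (b : ℕ) .{{_ : NonZero b}} where

  digitwise : ℚ → ∀ N → (j k : ℕ) → Fin N → ℚ
  digitwise x N j k i = S₁-entry x (digit b (toℕ i) j) (digit b (toℕ i) k)

  S≡∏-digitwise : ∀ N x (j k : Fin (b ^ suc N)) → S b (suc N) x j k ≡ ∏ (suc N) (digitwise x (suc N) (toℕ j) (toℕ k))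
  S≡∏-digitwise zero    x j k = begin
    S₁ (b ^ 1) x j k                                ≡⟨ S₁≡S₁-entry (b ^ 1) x j k ⟩
    S₁-entry x (toℕ j) (toℕ k)                      ≡⟨ sym (cong₂ (S₁-entry x) (one-digit j) (one-digit k)) ⟩
    S₁-entry x (toℕ j % b) (toℕ k % b)              ≡⟨ sym (*-identityʳ _) ⟩
    ∏ 1 (digitwise x 1 (toℕ j) (toℕ k))             ∎
    where
    one-digit : (i : Fin (b ^ 1)) → toℕ i % b ≡ toℕ i
    one-digit i = m<n⇒m%n≡m (subst (toℕ i <_) (ℕ.*-identityʳ b) (toℕ<n i))
  S≡∏-digitwise (suc N) x j k = begin
    S₁ b x (lead j) (lead k) * S b (suc N) x (rest j) (rest k)
      ≡⟨ cong₂ _*_ (S₁≡S₁-entry b x (lead j) (lead k)) (S≡∏-digitwise N x (rest j) (rest k)) ⟩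
    S₁-entry x (toℕ (lead j)) (toℕ (lead k)) * ∏ (suc N) (digitwise x (suc N) (toℕ (rest j)) (toℕ (rest k)))
      ≡⟨ *-comm (S₁-entry x (toℕ (lead j)) (toℕ (lead k))) _ ⟩
    ∏ (suc N) (digitwise x (suc N) (toℕ (rest j)) (toℕ (rest k))) * S₁-entry x (toℕ (lead j)) (toℕ (lead k))
      ≡⟨ sym (cong₂ _*_ (∏-cong (suc N) (λ t → cong₂ (S₁-entry x) (low-digit j t) (low-digit k t)))
                        (cong₂ (S₁-entry x) (leading-digit j) (leading-digit k))) ⟩
    ∏ (suc N) (λ t → f (inject₁ t)) * f (fromℕ (suc N))
      ≡⟨ sym (∏-snoc (suc N) f) ⟩
    ∏ (suc (suc N)) f ∎
    where
    f : Fin (suc (suc N)) → ℚ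
    f = digitwise x (suc (suc N)) (toℕ j) (toℕ k)
    lead : Fin (b ^ suc (suc N)) → Fin b
    lead = quotient {b} (b ^ suc N)
    rest : Fin (b ^ suc (suc N)) → Fin (b ^ suc N)
    rest = remainder {b} (b ^ suc N)
    low-digit : ∀ i (t : Fin (suc N)) → digit b (toℕ (inject₁ t)) (toℕ i) ≡ digit b (toℕ t) (toℕ (rest i))
    low-digit i t rewrite toℕ-inject₁ t | toℕ-remQuot {b} (b ^ suc N) i =
      digit-low b (suc N) (toℕ (lead i)) (toℕ (rest i)) (toℕ<n t) (toℕ<n (rest i))
    leading-digit : ∀ i → digit b (toℕ (fromℕ (suc N))) (toℕ i) ≡ toℕ (lead i)
    leading-digit i rewrite toℕ-fromℕ N | toℕ-remQuot {b} (b ^ suc N) i =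
      trans (digit-high b (suc N) (toℕ (lead i)) (toℕ (rest i)) (toℕ<n (rest i))) (m<n⇒m%n≡m (toℕ<n (lead i)))

theorem2p2 : (b N : ℕ) → .{{_ : NonZero b}} → 2 ≤ b → 1 ≤ N → (x : ℚ) → (j k : Fin (b ^ N)) →
    ((toℕ k ≤ toℕ j × toℕ k ⪯[ b , N ] toℕ j) →
      S b N x j k ≡ ∏ N (λ i → binom (x + ℕ→ℚ (digit b (toℕ i) (toℕ j ∸ toℕ k)) - 1ℚ) (digit b (toℕ i) (toℕ j ∸ toℕ k))))
  × (¬ (toℕ k ≤ toℕ j × toℕ k ⪯[ b , N ] toℕ j) → S b N x j k ≡ 0ℚ)
theorem2p2 b (suc N) _ _ x j k = dominated , not-dominated
  where
  factorised : S b (suc N) x j k ≡ ∏ (suc N) (digitwise b x (suc N) (toℕ j) (toℕ k))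
  factorised = S≡∏-digitwise b N x j k
  dominated : toℕ k ≤ toℕ j × toℕ k ⪯[ b , suc N ] toℕ j →
              S b (suc N) x j k ≡ ∏ (suc N) (λ i → multichoose x (digit b (toℕ i) (toℕ j ∸ toℕ k)))
  dominated (k≤j , k⪯j) = trans factorised (∏-cong (suc N) λ i →
    trans (S₁-entry-≤ x (k⪯j i)) (cong (multichoose x) (sym (digit-∸ b (toℕ k) (toℕ j) k≤j k⪯j i))))
  not-dominated : ¬ (toℕ k ≤ toℕ j × toℕ k ⪯[ b , suc N ] toℕ j) → S b (suc N) x j k ≡ 0ℚ
  not-dominated ¬k≤j×k⪯j =
    let k⋠j = λ k⪯j → ¬k≤j×k⪯j (⪯⇒≤ b (suc N) (toℕ k) (toℕ j) (toℕ<n k) k⪯j , k⪯j)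
        (i , digit-k≰digit-j) = ¬⪯⇒digit> b (toℕ k) (toℕ j) k⋠j
    in trans factorised (∏-zero (digitwise b x (suc N) (toℕ j) (toℕ k)) i (S₁-entry-≰ x digit-k≰digit-j))
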